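{- For every $1\le j\le\mathtt w$, $\ell_j\le\mathtt h''+1$, where $\mathtt h''$ is the number of indices $i$ with $1\le i<\mathtt h$ and $S_i\ne S_{i+1}$.
   Context: Let $S_1,\dots,S_{\mathtt h}$ be strings (haplotypes), not necessarily distinct, each of length $\mathtt w$ over the ordered alphabet $\{0,\dots,\sigma-1\}$. The prefix array $\mathrm{PA}$ is the $\mathtt h\times\mathtt w$ matrix whose column 1 is $1,\dots,\mathtt h$ and whose column $j>1$ lists the indices $k$ sorted by the co-lexicographic order (comparison from the last symbol backwards) of $S_k[1..j-1]$, ties broken by increasing $k$. An interval $[b,e]$ of rows is canonical with respect to column $j$ if it is a maximal interval such that $S_{\mathrm{PA}[b][j]}=S_{\mathrm{PA}[b+1][j]}=\dots=S_{\mathrm{PA}[e][j]}$ (equality of whole strings); $\ell_j$ is the number of canonical intervals with respect to column $j$. -}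

module Defs where

open import Data.Nat using (ℕ; zero; suc; _+_; _<ᵇ_)
open import Data.Bool using (Bool; true; false; _∧_; _∨_; not; if_then_else_)
open import Data.Fin as Fin using (Fin; toℕ)
open import Data.Vec as Vec using (Vec; lookup; toList; take)
open import Data.Vec.Properties using (≡-dec)
open import Data.List as List using (List; []; _∷_; length; reverse; allFin; map)
open import Relation.Nullary using (does)

-- Rows/columns/haplotype indices are 0-based internally: haplotype k : Fin h is S_{k+1},
-- column j : Fin w is column (toℕ j + 1) of the paper.
Haps : ℕ → ℕ → ℕ → Set
Haps σ h w = Vec (Vec (Fin σ) w) h

module _ {σ h w : ℕ} (S : Haps σ h w) where

  strEq : Fin h → Fin h → Bool
  strEq a b = does (≡-dec Fin._≟_ (lookup S a) (lookup S b))

  -- S_k[1..j-1] for paper column j = toℕ c + 1, as a list of symbols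
  prefix : Fin w → Fin h → List ℕ
  prefix c k = List.map toℕ (List.take (toℕ c) (toList (lookup S k)))

lexLt : List ℕ → List ℕ → Bool
lexLt []       []       = false
lexLt []       (_ ∷ _)  = true
lexLt (_ ∷ _)  []       = false
lexLt (x ∷ xs) (y ∷ ys) = (x <ᵇ y) ∨ (not (y <ᵇ x) ∧ lexLt xs ys)

colexLt : List ℕ → List ℕ → Bool
colexLt u v = lexLt (reverse u) (reverse v)

insert : {A : Set} → (A → A → Bool) → A → List A → List A
insert lt x []       = x ∷ []
insert lt x (y ∷ ys) = if lt y x then y ∷ insert lt x ys else x ∷ y ∷ ys

isort : {A : Set} → (A → A → Bool) → List A → List A
isort lt []       = []
isort lt (x ∷ xs) = insert lt x (isort lt xs)

module _ {σ h w : ℕ} (S : Haps σ h w) where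

  before : Fin w → Fin h → Fin h → Bool
  before c k k' =
    colexLt (prefix S c k) (prefix S c k')
    ∨ (not (colexLt (prefix S c k') (prefix S c k)) ∧ (toℕ k <ᵇ toℕ k'))

  PAcol : Fin w → List (Fin h)
  PAcol c = isort (before c) (allFin h)

  runs : List (Fin h) → ℕ
  runs []           = 0
  runs (x ∷ [])     = 1
  runs (x ∷ y ∷ xs) = (if strEq S x y then 0 else 1) + runs (y ∷ xs)

  -- ℓ_j : number of canonical intervals with respect to column j
  ell : Fin w → ℕ
  ell c = runs (PAcol c)

  changes : List (Fin h) → ℕ
  changes []           = 0
  changes (x ∷ [])     = 0
  changes (x ∷ y ∷ xs) = (if strEq S x y then 0 else 1) + changes (y ∷ xs)

  h'' : ℕ
  h'' = changes (allFin h)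

{-# OPTIONS --safe #-}
module Submission where

-- Insertion sort only ever compares the row
-- being inserted with rows of larger index, so the index tie-break never fires and the column
-- is sorted by an irreflexive order that depends on the strings alone. Such a sort never
-- increases the number of adjacent rows with different strings: a row whose string equals that
-- of its successor in the input is inserted right before that successor, and any other row
-- cannot be inserted between two equal strings, so it creates at most one new difference.
-- Hence ℓ_j ≤ (differences in column j) + 1 ≤ h'' + 1.

open import Defs
open import Data.Nat using (ℕ; _≤_; _+_; suc; _<_; _<ᵇ_; z≤n)
open import Data.Nat.Properties
  using (_<?_; n≮n; <⇒≯; ≤-refl; ≤-reflexive; ≤-trans; +-mono-≤; +-monoˡ-≤; +-monoʳ-≤; +-suc; +-assoc;
         module ≤-Reasoning)
open import Data.Fin as Fin using (Fin; toℕ)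
open import Data.Bool using (Bool; true; false; not; if_then_else_)
open import Data.Bool.Properties using (∧-zeroʳ; ∨-identityʳ)
open import Data.List as List using (List; []; _∷_; _++_; allFin)
open import Data.List.Relation.Unary.All using (All; []; _∷_)
open import Data.List.Relation.Unary.AllPairs using (AllPairs; []; _∷_)
open import Data.List.Relation.Unary.AllPairs.Properties using (tabulate⁺-<)
open import Data.Product using (∃₂; _×_; _,_)
open import Data.Vec using (Vec; lookup; toList)
open import Data.Vec.Properties using (≡-dec)
open import Function using (_on_; _∘_)
open import Relation.Nullary using (yes; no; contradiction)
open import Relation.Nullary.Decidable using (dec-true; dec-false)
open import Relation.Binary.PropositionalEquality using (_≡_; refl; cong; module ≡-Reasoning)

module _ {A : Set} (lt : A → A → Bool) where

  All-insert : ∀ {P : A → Set} {x} {ys} → P x → All P ys → All P (insert lt x ys)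
  All-insert {ys = []}     px []         = px ∷ []
  All-insert {x = x} {ys = y ∷ ys} px (py ∷ pys) with lt y x
  ... | true  = py ∷ All-insert px pys
  ... | false = px ∷ py ∷ pys

  All-isort : ∀ {P : A → Set} {xs} → All P xs → All P (isort lt xs)
  All-isort []         = []
  All-isort (px ∷ pxs) = All-insert px (All-isort pxs)

module _ {A : Set} {lt lt′ : A → A → Bool} where

  insert-cong : ∀ {x} {ys} → All (λ y → lt y x ≡ lt′ y x) ys → insert lt x ys ≡ insert lt′ x ys
  insert-cong []                    = refl
  insert-cong {x} {y ∷ ys} (e ∷ es) rewrite e | insert-cong es = refl

  isort-cong : ∀ {xs} → AllPairs (λ x y → lt y x ≡ lt′ y x) xs → isort lt xs ≡ isort lt′ xs
  isort-cong []                  = refl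
  isort-cong {x ∷ xs} (px ∷ pxs) = begin
    insert lt x (isort lt xs)   ≡⟨ cong (insert lt x) (isort-cong pxs) ⟩
    insert lt x (isort lt′ xs)  ≡⟨ insert-cong (All-isort lt′ px) ⟩
    insert lt′ x (isort lt′ xs) ∎
    where open ≡-Reasoning

module _ {σ h w : ℕ} (S : Haps σ h w) where

  differ : Fin h → Fin h → ℕ
  differ a b = if strEq S a b then 0 else 1

  differ≤1 : ∀ a b → differ a b ≤ 1
  differ≤1 a b with strEq S a b
  ... | true  = z≤n
  ... | false = ≤-refl

  changes-cons : ∀ x xs → changes S (x ∷ xs) ≤ suc (changes S xs)
  changes-cons x []       = z≤n
  changes-cons x (y ∷ ys) = +-monoˡ-≤ _ (differ≤1 x y)

  runs≤changes+1 : ∀ xs → runs S xs ≤ changes S xs + 1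
  runs≤changes+1 []           = z≤n
  runs≤changes+1 (x ∷ [])     = ≤-refl
  runs≤changes+1 (x ∷ y ∷ xs) = begin
    differ x y + runs S (y ∷ xs)          ≤⟨ +-monoʳ-≤ (differ x y) (runs≤changes+1 (y ∷ xs)) ⟩
    differ x y + (changes S (y ∷ xs) + 1) ≡⟨ +-assoc (differ x y) _ 1 ⟨
    differ x y + changes S (y ∷ xs) + 1   ∎
    where open ≤-Reasoning

  changes-twin : ∀ {x x′} pre post → lookup S x ≡ lookup S x′ →
                 changes S (pre ++ x ∷ x′ ∷ post) ≡ changes S (pre ++ x′ ∷ post)
  changes-twin {x} {x′} [] post same
    rewrite dec-true (≡-dec Fin._≟_ (lookup S x) (lookup S x′)) same = refl
  changes-twin {x} {x′} (a ∷ []) post same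
    rewrite same | dec-true (≡-dec Fin._≟_ (lookup S x′) (lookup S x′)) refl = refl
  changes-twin (a ∷ b ∷ pre) post same =
    cong (differ a b +_) (changes-twin (b ∷ pre) post same)

module _ {σ h w : ℕ} (S : Haps σ h w) (r : Vec (Fin σ) w → Vec (Fin σ) w → Bool)
         (r-irrefl : ∀ u → r u u ≡ false) where

  private
    lt : Fin h → Fin h → Bool
    lt = r on lookup S

  changes-insert-after : ∀ q x ys → lt q x ≡ true →
                         changes S (q ∷ insert lt x ys) ≤ suc (changes S (q ∷ ys))
  changes-insert-after q x []       _ = changes-cons S q (x ∷ [])
  changes-insert-after q x (z ∷ zs) q<x with lt z x in z<x
  ... | true = begin
    differ S q z + changes S (z ∷ insert lt x zs)
      ≤⟨ +-monoʳ-≤ (differ S q z) (changes-insert-after z x zs z<x) ⟩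
    differ S q z + suc (changes S (z ∷ zs)) ≡⟨ +-suc (differ S q z) _ ⟩
    suc (differ S q z + changes S (z ∷ zs)) ∎
    where open ≤-Reasoning
  ... | false with ≡-dec Fin._≟_ (lookup S q) (lookup S z)
  ...   | no _     = +-mono-≤ (differ≤1 S q x) (+-monoˡ-≤ _ (differ≤1 S x z))
  ...   | yes same = contradiction q<x≡z<x λ ()
    where
    -- x would land between q and z, but equal strings compare alike with x.
    q<x≡z<x : true ≡ false
    q<x≡z<x = begin
      true   ≡⟨ q<x ⟨
      lt q x ≡⟨ cong (λ u → r u (lookup S x)) same ⟩
      lt z x ≡⟨ z<x ⟩
      false  ∎
      where open ≡-Reasoning

  changes-insert : ∀ x ys → changes S (insert lt x ys) ≤ suc (changes S ys)
  changes-insert x []       = z≤n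
  changes-insert x (y ∷ ys) with lt y x in y<x
  ... | true  = changes-insert-after y x ys y<x
  ... | false = changes-cons S x (y ∷ ys)

  insert-twin : ∀ {x x′} ys → lookup S x ≡ lookup S x′ →
                ∃₂ λ pre post → insert lt x′ ys ≡ pre ++ x′ ∷ post
                              × insert lt x (insert lt x′ ys) ≡ pre ++ x ∷ x′ ∷ post
  insert-twin {x} {x′} [] same rewrite same | r-irrefl (lookup S x′) = [] , [] , refl , refl
  insert-twin {x} {x′} (y ∷ ys) same with lt y x′ in y<x′
  ... | true rewrite same | y<x′ with insert-twin ys same
  ...   | pre , post , eq , eq′ = y ∷ pre , post , cong (y ∷_) eq , cong (y ∷_) eq′
  insert-twin {x} {x′} (y ∷ ys) same | false rewrite same | r-irrefl (lookup S x′) =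
    [] , y ∷ ys , refl , refl

  changes-insert-isort : ∀ x x′ xs →
    changes S (insert lt x (isort lt (x′ ∷ xs))) ≤ differ S x x′ + changes S (isort lt (x′ ∷ xs))
  changes-insert-isort x x′ xs with ≡-dec Fin._≟_ (lookup S x) (lookup S x′)
  ... | no _     = changes-insert x (isort lt (x′ ∷ xs))
  ... | yes same with insert-twin (isort lt xs) same
  ...   | pre , post , eq , eq′ = ≤-reflexive (begin
    changes S (insert lt x (insert lt x′ (isort lt xs))) ≡⟨ cong (changes S) eq′ ⟩
    changes S (pre ++ x ∷ x′ ∷ post)                     ≡⟨ changes-twin S pre post same ⟩
    changes S (pre ++ x′ ∷ post)                         ≡⟨ cong (changes S) eq ⟨
    changes S (insert lt x′ (isort lt xs))               ∎)
    where open ≡-Reasoning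

  changes-isort : ∀ xs → changes S (isort lt xs) ≤ changes S xs
  changes-isort []            = z≤n
  changes-isort (x ∷ [])      = z≤n
  changes-isort (x ∷ x′ ∷ xs) =
    ≤-trans (changes-insert-isort x x′ xs) (+-monoʳ-≤ (differ S x x′) (changes-isort (x′ ∷ xs)))

<ᵇ-irrefl : ∀ n → (n <ᵇ n) ≡ false
<ᵇ-irrefl n = dec-false (n <? n) (n≮n n)

<ᵇ-asym : ∀ {m n} → m < n → (n <ᵇ m) ≡ false
<ᵇ-asym {m} {n} m<n = dec-false (n <? m) (<⇒≯ m<n)

lexLt-irrefl : ∀ xs → lexLt xs xs ≡ false
lexLt-irrefl []       = refl
lexLt-irrefl (x ∷ xs) rewrite <ᵇ-irrefl x = lexLt-irrefl xs

colexLt-irrefl : ∀ xs → colexLt xs xs ≡ false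
colexLt-irrefl xs = lexLt-irrefl (List.reverse xs)

stringPrefix : ∀ {σ w} → Fin w → Vec (Fin σ) w → List ℕ
stringPrefix c u = List.map toℕ (List.take (toℕ c) (toList u))

module _ {σ h w : ℕ} (S : Haps σ h w) (c : Fin w) where

  before-later : ∀ {k k′} → toℕ k < toℕ k′ →
                 before S c k′ k ≡ colexLt (prefix S c k′) (prefix S c k)
  before-later {k} {k′} k<k′
    rewrite <ᵇ-asym k<k′ | ∧-zeroʳ (not (colexLt (prefix S c k) (prefix S c k′))) = ∨-identityʳ _

  PAcol-by-prefix : PAcol S c ≡ isort ((colexLt on stringPrefix c) on lookup S) (allFin h)
  PAcol-by-prefix = isort-cong (tabulate⁺-< before-later)

lemma5 : (σ h w : ℕ) (S : Haps σ h w) (j : Fin w) →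
    ell S j ≤ h'' S + 1
lemma5 σ h w S j = begin
  runs S (PAcol S j)        ≤⟨ runs≤changes+1 S (PAcol S j) ⟩
  changes S (PAcol S j) + 1 ≡⟨ cong (λ xs → changes S xs + 1) (PAcol-by-prefix S j) ⟩
  changes S (isort (prefixOrder on lookup S) (allFin h)) + 1
    ≤⟨ +-monoˡ-≤ 1 (changes-isort S prefixOrder (colexLt-irrefl ∘ stringPrefix j) (allFin h)) ⟩
  h'' S + 1                 ∎
  where
  open ≤-Reasoning
  prefixOrder : Vec (Fin σ) w → Vec (Fin σ) w → Bool
  prefixOrder = colexLt on stringPrefix j
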